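{- Let $D=(X,Y,E)$ be a homogeneous $2$-partite digraph. If $v\in X\cup Y$ is a vertex such that $N^+(v)$ and $N^-(v)$ are infinite and $v^\perp$ is finite, then $v^\perp=\emptyset$.
   Context: A $2$-partite digraph is a triple $D=(X,Y,E)$ of pairwise disjoint sets with $E\subseteq (X\times Y)\cup(Y\times X)$ such that $(u,v)\in E$ implies $(v,u)\notin E$; we write $uv$ for $(u,v)\in E$. For a vertex $u$, $N^+(u)=\{w\mid uw\in E\}$ and $N^-(u)=\{w\mid wu\in E\}$. Two vertices $u,v$ are adjacent if $uv\in E$ or $vu\in E$. For $x\in X$, $x^\perp=\{y\in Y\mid y\text{ not adjacent to }x\}$, and for $y\in Y$, $y^\perp=\{x\in X\mid x\text{ not adjacent to }y\}$. $D$ is homogeneous if every isomorphism $\varphi$ between finite induced subdigraphs $A$ and $B$ of $D$ with $(VA\cap X)\varphi\subseteq X$ and $(VA\cap Y)\varphi\subseteq Y$ extends to an automorphism $\alpha$ of $D$ with $X\alpha=X$ and $Y\alpha=Y$. -}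

module Defs where

open import Level using (0ℓ)
open import Data.Nat using (ℕ)
open import Data.Fin using (Fin)
open import Data.Sum using (_⊎_; inj₁; inj₂)
open import Data.Product using (Σ; ∃; _×_; _,_)
open import Data.Empty using (⊥)
open import Data.Unit using (⊤)
open import Data.List using (List)
open import Data.List.Membership.Propositional using (_∈_)
open import Relation.Nullary using (¬_)
open import Relation.Binary.PropositionalEquality using (_≡_)
open import Function.Bundles using (_↔_; Inverse)

-- A 2-partite digraph D = (X, Y, E).  The vertex set is the disjoint
-- union X ⊎ Y (so X and Y are automatically disjoint); E u v means uv ∈ E.
record TwoPartiteDigraph : Set₁ where
  field
    X : Set
    Y : Set
    E : X ⊎ Y → X ⊎ Y → Set
    E-XX : ∀ {a b} → ¬ E (inj₁ a) (inj₁ b)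
    E-YY : ∀ {a b} → ¬ E (inj₂ a) (inj₂ b)
    E-asym : ∀ {u v} → E u v → ¬ E v u

  V : Set
  V = X ⊎ Y

  N⁺ : V → V → Set
  N⁺ u w = E u w

  N⁻ : V → V → Set
  N⁻ u w = E w u

  Adjacent : V → V → Set
  Adjacent u v = E u v ⊎ E v u

  _⊥' : V → V → Set
  (inj₁ x ⊥') (inj₁ _) = ⊥
  (inj₁ x ⊥') (inj₂ y) = ¬ Adjacent (inj₁ x) (inj₂ y)
  (inj₂ y ⊥') (inj₁ x) = ¬ Adjacent (inj₂ y) (inj₁ x)
  (inj₂ y ⊥') (inj₂ _) = ⊥

InX : ∀ {A B : Set} → A ⊎ B → Set
InX (inj₁ _) = ⊤
InX (inj₂ _) = ⊥

Finite : {A : Set} → (A → Set) → Set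
Finite {A} P = Σ (List A) λ xs → ∀ a → P a → a ∈ xs

Infinite : {A : Set} → (A → Set) → Set
Infinite P = ¬ Finite P

Empty : {A : Set} → (A → Set) → Set
Empty {A} P = ∀ a → ¬ P a

module _ (D : TwoPartiteDigraph) where
  open TwoPartiteDigraph D

  record Automorphism : Set where
    field
      α : V ↔ V
    open Inverse α public using (to; from)
    field
      preserves-E : ∀ u v → (E u v → E (to u) (to v)) × (E (to u) (to v) → E u v)
      preserves-X : ∀ u → (InX u → InX (to u)) × (InX (to u) → InX u)

  -- An isomorphism between finite induced subdigraphs A and B, given by
  -- enumerations a, b : Fin n → V of their vertex sets (injective), with
  -- φ (a i) = b i, respecting the parts X and Y.
  record FinitePartialIso : Set where
    field
      n : ℕ
      a : Fin n → V
      b : Fin n → V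
      a-inj : ∀ i j → a i ≡ a j → i ≡ j
      b-inj : ∀ i j → b i ≡ b j → i ≡ j
      iso-E : ∀ i j → (E (a i) (a j) → E (b i) (b j)) × (E (b i) (b j) → E (a i) (a j))
      parts : ∀ i → (InX (a i) → InX (b i)) × (InX (b i) → InX (a i))

  Homogeneous : Set
  Homogeneous = (φ : FinitePartialIso) →
    Σ Automorphism λ σ → ∀ i →
      Automorphism.to σ (FinitePartialIso.a φ i) ≡ FinitePartialIso.b φ i

module Submission where

-- Suppose t ∈ v^⊥, and pick y₁ ∈ N⁺(v), y₂ ∈ N⁻(v).  All of these lie on
-- the side opposite to v, so they span no edges.  Homogeneity then gives:
--   (A) an automorphism fixing v^⊥ pointwise with y₁ ↦ y₂; it sends v to
--       some v' ≠ v on v's side with v^⊥ ⊆ v'^⊥;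
--   (B) an automorphism with y₁ ↦ t; it sends v to some u ≠ v with u → t;
--   (C) an automorphism fixing v with v' ↦ u; pulling t back along it gives
--       s ∈ v^⊥ adjacent to v', contradicting (A).
-- Step (A) needs v^⊥ as an injectively enumerated finite set.  Such an
-- enumeration of a finite predicate exists only up to double negation, which
-- is harmless because the goal is ⊥.

open import Defs

open import Data.Bool using (Bool; true; false; not)
open import Data.Bool.Properties using (¬-not)
open import Data.Empty using (⊥-elim)
open import Data.Fin using (Fin; zero; suc)
open import Data.List using (List; []; _∷_)
open import Data.List.Membership.Propositional using (_∈_)
open import Data.List.Relation.Unary.Any using (here; there)
open import Data.Nat using (ℕ; suc)
open import Data.Product using (Σ-syntax; ∃; _×_; _,_; proj₁; proj₂)
open import Data.Sum using (_⊎_; inj₁; inj₂)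
open import Data.Unit using (tt)
open import Data.Vec.Functional using () renaming ([] to []ᵛ; _∷_ to _∷ᵛ_)
open import Effect.Monad using (RawMonad)
open import Function.Bundles using (Inverse)
open import Function.Definitions using (Injective)
open import Level using (0ℓ)
open import Relation.Binary.PropositionalEquality
open import Relation.Nullary using (¬_; Dec; yes; no)
open import Relation.Nullary.Decidable using (¬¬-excluded-middle)
open import Relation.Nullary.Negation using (¬¬-Monad)

open RawMonad (¬¬-Monad {0ℓ}) using (pure; _>>=_)

record Enumeration {A : Set} (P : A → Set) : Set where
  field
    size      : ℕ
    elem      : Fin size → A
    injective : Injective _≡_ _≡_ elem
    sound     : ∀ i → P (elem i)
    complete  : ∀ a → P a → ∃ λ i → elem i ≡ a

∷-injective : ∀ {A : Set} {n} {w : A} {T : Fin n → A} →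
              Injective _≡_ _≡_ T → (∀ i → T i ≢ w) →
              Injective _≡_ _≡_ (w ∷ᵛ T)
∷-injective inj fresh {zero}  {zero}  _  = refl
∷-injective inj fresh {zero}  {suc j} eq = ⊥-elim (fresh j (sym eq))
∷-injective inj fresh {suc i} {zero}  eq = ⊥-elim (fresh i eq)
∷-injective inj fresh {suc i} {suc j} eq = cong suc (inj eq)

_∩_ : ∀ {A : Set} → (A → Set) → List A → A → Set
(P ∩ L) a = P a × a ∈ L

module _ {A : Set} {P : A → Set} where

  relisting : ∀ {w L} (e : Enumeration (P ∩ L)) →
              (∀ a → (P ∩ (w ∷ L)) a → ∃ λ i → Enumeration.elem e i ≡ a) →
              Enumeration (P ∩ (w ∷ L))
  relisting e complete′ = record
    { size = size ; elem = elem ; injective = injective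
    ; sound = λ i → proj₁ (sound i) , there (proj₂ (sound i))
    ; complete = complete′ }
    where open Enumeration e

  enumeration-∷ : ∀ {w L} (e : Enumeration (P ∩ L)) → Dec (P w) →
                  Dec (∃ λ i → Enumeration.elem e i ≡ w) →
                  Enumeration (P ∩ (w ∷ L))
  enumeration-∷ e (no ¬Pw) _ = relisting e λ where
    a (Pa , here refl) → ⊥-elim (¬Pw Pa)
    a (Pa , there a∈L) → Enumeration.complete e a (Pa , a∈L)
  enumeration-∷ e (yes _) (yes (j , elem-j≡w)) = relisting e λ where
    a (Pa , here refl) → j , elem-j≡w
    a (Pa , there a∈L) → Enumeration.complete e a (Pa , a∈L)
  enumeration-∷ {w} e (yes Pw) (no unlisted) = record
    { size      = suc size
    ; elem      = w ∷ᵛ elem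
    ; injective = ∷-injective injective (λ i eq → unlisted (i , eq))
    ; sound     = λ where
        zero    → Pw , here refl
        (suc i) → proj₁ (sound i) , there (proj₂ (sound i))
    ; complete  = λ where
        a (Pa , here refl) → zero , refl
        a (Pa , there a∈L) → let (i , eq) = complete a (Pa , a∈L) in suc i , eq
    }
    where open Enumeration e

  enumerate-∩ : (L : List A) → ¬ ¬ Enumeration (P ∩ L)
  enumerate-∩ [] = pure record
    { size = 0 ; elem = []ᵛ ; injective = λ { {()} } ; sound = λ ()
    ; complete = λ { a (_ , ()) } }
  enumerate-∩ (w ∷ L) = do
    e ← enumerate-∩ L
    Pw? ← ¬¬-excluded-middle
    listed? ← ¬¬-excluded-middle
    pure (enumeration-∷ e Pw? listed?)

  finite⇒enumerable : Finite P → ¬ ¬ Enumeration P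
  finite⇒enumerable (L , covers) = do
    e ← enumerate-∩ L
    let open Enumeration e
    pure record
      { size = size ; elem = elem ; injective = injective
      ; sound = λ i → proj₁ (sound i)
      ; complete = λ a Pa → complete a (Pa , covers a Pa) }

  infinite⇒inhabited : Infinite P → ¬ ¬ ∃ P
  infinite⇒inhabited infinite no-witness =
    infinite ([] , λ a Pa → ⊥-elim (no-witness (a , Pa)))

finite-⊆ : ∀ {A : Set} {P Q : A → Set} → (∀ a → Q a → P a) → Finite P → Finite Q
finite-⊆ Q⊆P (L , covers) = L , λ a Qa → covers a (Q⊆P a Qa)

singleton-injective : ∀ {A : Set} (x : A) → Injective _≡_ _≡_ (x ∷ᵛ []ᵛ)
singleton-injective x = ∷-injective (λ { {()} }) (λ ())

pair-injective : ∀ {A : Set} {x y : A} → y ≢ x → Injective _≡_ _≡_ (x ∷ᵛ y ∷ᵛ []ᵛ)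
pair-injective {y = y} y≢x = ∷-injective (singleton-injective y) λ { zero → y≢x }

differ-from-same⇒agree : ∀ {a b c : Bool} → a ≢ c → b ≢ c → a ≡ b
differ-from-same⇒agree a≢c b≢c = trans (¬-not a≢c) (sym (¬-not b≢c))

side : {A B : Set} → A ⊎ B → Bool
side (inj₁ _) = true
side (inj₂ _) = false

same-side⇒same-part : ∀ {A B : Set} {u w : A ⊎ B} → side u ≡ side w →
                      (InX u → InX w) × (InX w → InX u)
same-side⇒same-part {u = inj₁ _} {inj₁ _} _ = (λ x → x) , (λ x → x)
same-side⇒same-part {u = inj₂ _} {inj₂ _} _ = (λ x → x) , (λ x → x)

same-part⇒same-side : ∀ {A B : Set} {u w : A ⊎ B} →
                      (InX u → InX w) × (InX w → InX u) → side u ≡ side w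
same-part⇒same-side {u = inj₁ _} {inj₁ _} _       = refl
same-part⇒same-side {u = inj₁ _} {inj₂ _} (u⇒w , _) = ⊥-elim (u⇒w tt)
same-part⇒same-side {u = inj₂ _} {inj₁ _} (_ , w⇒u) = ⊥-elim (w⇒u tt)
same-part⇒same-side {u = inj₂ _} {inj₂ _} _       = refl

module Basics (D : TwoPartiteDigraph) where
  open TwoPartiteDigraph D

  edge-crosses : ∀ {u w} → E u w → side u ≢ side w
  edge-crosses {inj₁ _} {inj₁ _} uw = ⊥-elim (E-XX uw)
  edge-crosses {inj₁ _} {inj₂ _} uw ()
  edge-crosses {inj₂ _} {inj₁ _} uw ()
  edge-crosses {inj₂ _} {inj₂ _} uw = ⊥-elim (E-YY uw)

  -- w ∈ v^⊥, phrased without case analysis on the sides of v and w.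
  Perp : V → V → Set
  Perp v w = ¬ Adjacent v w × side v ≢ side w

  ⊥'⇒Perp : ∀ v w → (v ⊥') w → Perp v w
  ⊥'⇒Perp (inj₁ _) (inj₂ _) non-adjacent = non-adjacent , λ ()
  ⊥'⇒Perp (inj₂ _) (inj₁ _) non-adjacent = non-adjacent , λ ()

  Perp⇒⊥' : ∀ v w → Perp v w → (v ⊥') w
  Perp⇒⊥' (inj₁ _) (inj₁ _) (_ , different) = different refl
  Perp⇒⊥' (inj₁ _) (inj₂ _) (non-adjacent , _) = non-adjacent
  Perp⇒⊥' (inj₂ _) (inj₁ _) (non-adjacent , _) = non-adjacent
  Perp⇒⊥' (inj₂ _) (inj₂ _) (_ , different) = different refl

  perp-not-neighbour : ∀ {v w y} → Perp v w → Adjacent v y → w ≢ y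
  perp-not-neighbour (non-adjacent , _) vy refl = non-adjacent vy

  module AutomorphismFacts (σ : Automorphism D) where
    open Automorphism σ public using (to; from)
    open Automorphism σ using (α; preserves-E; preserves-X)

    maps-E : ∀ {u w} → E u w → E (to u) (to w)
    maps-E {u} {w} = proj₁ (preserves-E u w)

    maps-adjacent : ∀ {u w} → Adjacent u w → Adjacent (to u) (to w)
    maps-adjacent (inj₁ uw) = inj₁ (maps-E uw)
    maps-adjacent (inj₂ wu) = inj₂ (maps-E wu)

    reflects-adjacent : ∀ {u w} → Adjacent (to u) (to w) → Adjacent u w
    reflects-adjacent {u} {w} (inj₁ uw) = inj₁ (proj₂ (preserves-E u w) uw)
    reflects-adjacent {u} {w} (inj₂ wu) = inj₂ (proj₂ (preserves-E w u) wu)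

    preserves-side : ∀ u → side (to u) ≡ side u
    preserves-side u = sym (same-part⇒same-side (preserves-X u))

    maps-perp : ∀ {v w} → Perp v w → Perp (to v) (to w)
    maps-perp {v} {w} (non-adjacent , different) =
        (λ adjacent → non-adjacent (reflects-adjacent adjacent))
      , (λ same → different (trans (sym (preserves-side v))
                                   (trans same (preserves-side w))))

    reflects-perp : ∀ {v w} → Perp (to v) (to w) → Perp v w
    reflects-perp {v} {w} (non-adjacent , different) =
        (λ adjacent → non-adjacent (maps-adjacent adjacent))
      , (λ same → different (trans (preserves-side v)
                                   (trans same (sym (preserves-side w)))))

    to-from : ∀ w → to (from w) ≡ w
    to-from = Inverse.strictlyInverseˡ α

module Homogeneity (D : TwoPartiteDigraph) (H : Homogeneous D) where
  open TwoPartiteDigraph D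
  open Basics D

  -- Two equally long injective listings lying on one side span no edges, so
  -- a i ↦ b i is an isomorphism of induced subdigraphs; by homogeneity it
  -- extends to an automorphism.
  extend-on-side : ∀ {k} (c : Bool) (a b : Fin k → V) →
                   Injective _≡_ _≡_ a → Injective _≡_ _≡_ b →
                   (∀ i → side (a i) ≡ c) → (∀ i → side (b i) ≡ c) →
                   Σ[ σ ∈ Automorphism D ] (∀ i → Automorphism.to σ (a i) ≡ b i)
  extend-on-side {k} c a b a-inj b-inj a-side b-side = H record
    { n = k ; a = a ; b = b
    ; a-inj = λ _ _ → a-inj ; b-inj = λ _ _ → b-inj
    ; iso-E = λ i j → (λ e → ⊥-elim (no-edge a-side e))
                    , (λ e → ⊥-elim (no-edge b-side e))
    ; parts = λ i → same-side⇒same-part (trans (a-side i) (sym (b-side i)))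
    }
    where
    no-edge : {f : Fin k → V} → (∀ i → side (f i) ≡ c) → ∀ {i j} → ¬ E (f i) (f j)
    no-edge f-side {i} {j} e = edge-crosses e (trans (f-side i) (sym (f-side j)))

  perp-twin : ∀ {v y₁ y₂} → E v y₁ → E y₂ v → Enumeration (Perp v) →
              Σ[ v' ∈ V ] v' ≢ v × side v' ≡ side v × (∀ w → Perp v w → Perp v' w)
  perp-twin {v} {y₁} {y₂} v→y₁ y₂→v enum =
    to v , moved , preserves-side v , λ w v⊥w → subst (Perp (to v)) (fixes w v⊥w) (maps-perp v⊥w)
    where
    open Enumeration enum
    opposite-side : ∀ {y} → side y ≢ side v → ∀ i → side ((y ∷ᵛ elem) i) ≡ not (side v)
    opposite-side y-side zero    = ¬-not y-side
    opposite-side y-side (suc i) = ¬-not (λ same → proj₂ (sound i) (sym same))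
    σ-fixing : Σ[ σ ∈ Automorphism D ]
                 (∀ i → Automorphism.to σ ((y₁ ∷ᵛ elem) i) ≡ (y₂ ∷ᵛ elem) i)
    σ-fixing = extend-on-side (not (side v)) (y₁ ∷ᵛ elem) (y₂ ∷ᵛ elem)
      (∷-injective injective (λ i → perp-not-neighbour (sound i) (inj₁ v→y₁)))
      (∷-injective injective (λ i → perp-not-neighbour (sound i) (inj₂ y₂→v)))
      (opposite-side (λ same → edge-crosses v→y₁ (sym same)))
      (opposite-side (edge-crosses y₂→v))
    open AutomorphismFacts (proj₁ σ-fixing)
    moved : to v ≢ v
    moved same = E-asym y₂→v (subst₂ E same (proj₂ σ-fixing zero) (maps-E v→y₁))
    fixes : ∀ w → Perp v w → to w ≡ w
    fixes w v⊥w with complete w v⊥w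
    ... | i , refl = proj₂ σ-fixing (suc i)

  perp-has-in-neighbour : ∀ {v y₁ t} → E v y₁ → Perp v t →
                          Σ[ u ∈ V ] u ≢ v × side u ≡ side v × E u t
  perp-has-in-neighbour {v} {y₁} {t} v→y₁ v⊥t = to v , u≢v , preserves-side v , u→t
    where
    ρ-moving : Σ[ ρ ∈ Automorphism D ]
                 (∀ i → Automorphism.to ρ ((y₁ ∷ᵛ []ᵛ) i) ≡ (t ∷ᵛ []ᵛ) i)
    ρ-moving = extend-on-side (side t) (y₁ ∷ᵛ []ᵛ) (t ∷ᵛ []ᵛ)
      (singleton-injective y₁) (singleton-injective t)
      (λ { zero → differ-from-same⇒agree (λ same → edge-crosses v→y₁ (sym same))
                                          (λ same → proj₂ v⊥t (sym same)) })
      (λ { zero → refl })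
    open AutomorphismFacts (proj₁ ρ-moving)
    u→t : E (to v) t
    u→t = subst (E (to v)) (proj₂ ρ-moving zero) (maps-E v→y₁)
    u≢v : to v ≢ v
    u≢v same = proj₁ v⊥t (inj₁ (subst (λ x → E x t) same u→t))

  transfer-adjacency : ∀ {v v' u t} → v' ≢ v → u ≢ v →
                       side v' ≡ side v → side u ≡ side v →
                       Perp v t → Adjacent u t →
                       Σ[ s ∈ V ] Perp v s × Adjacent v' s
  transfer-adjacency {v} {v'} {u} {t} v'≢v u≢v v'-side u-side v⊥t u~t =
      from t
    , reflects-perp (subst₂ Perp (sym (proj₂ τ-moving zero)) (sym (to-from t)) v⊥t)
    , reflects-adjacent (subst₂ Adjacent (sym (proj₂ τ-moving (suc zero)))
                                         (sym (to-from t)) u~t)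
    where
    τ-moving : Σ[ τ ∈ Automorphism D ]
                 (∀ i → Automorphism.to τ ((v ∷ᵛ v' ∷ᵛ []ᵛ) i) ≡ (v ∷ᵛ u ∷ᵛ []ᵛ) i)
    τ-moving = extend-on-side (side v) (v ∷ᵛ v' ∷ᵛ []ᵛ) (v ∷ᵛ u ∷ᵛ []ᵛ)
      (pair-injective v'≢v) (pair-injective u≢v)
      (λ { zero → refl ; (suc zero) → v'-side })
      (λ { zero → refl ; (suc zero) → u-side })
    open AutomorphismFacts (proj₁ τ-moving)

open TwoPartiteDigraph

lemma3p2 : (D : TwoPartiteDigraph) → Homogeneous D → (v : V D) →
    Infinite (N⁺ D v) → Infinite (N⁻ D v) → Finite (_⊥' D v) →
    Empty (_⊥' D v)
lemma3p2 D H v out-infinite in-infinite perp-finite t t∈v⊥ =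
  infinite⇒inhabited out-infinite λ (y₁ , v→y₁) →
  infinite⇒inhabited in-infinite λ (y₂ , y₂→v) →
  finite⇒enumerable (finite-⊆ (Perp⇒⊥' v) perp-finite) λ perp-enumeration →
  let v⊥t = ⊥'⇒Perp v t t∈v⊥
      (v' , v'≢v , v'-side , v⊥⊆v'⊥) = perp-twin v→y₁ y₂→v perp-enumeration
      (u , u≢v , u-side , u→t) = perp-has-in-neighbour v→y₁ v⊥t
      (s , v⊥s , v'~s) = transfer-adjacency v'≢v u≢v v'-side u-side v⊥t (inj₁ u→t)
  in proj₁ (v⊥⊆v'⊥ s v⊥s) v'~s
  where
  open Basics D
  open Homogeneity D H
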